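{- For every positive integer $n$, \[(n+3)\,\mathcal{I}_{n+4}(n+4)=27n\,\mathcal{I}_n(n)+27\,\mathcal{I}_{n+1}(n+1)-9(2n+5)\,\mathcal{I}_{n+2}(n+2)+(8n+21)\,\mathcal{I}_{n+3}(n+3).\]
   Context: For positive integers $m,n$, let $T_{m,n}$ be the table with $m$ rows and $n$ columns of unit cells; the $(x,y)$-cell is in column $x$ (from the left) and row $y$ (from the bottom). Allowed steps are $(1,0),(1,1),(1,-1)$. A perfect lattice path in $T_{m,n}$ is a path starting at some cell of the first column and ending at some cell of the $n$-th column, using only the allowed steps and staying inside the table; equivalently, a sequence $(r_1,\dots,r_n)$ with $r_i\in\{1,\dots,m\}$ and $|r_{i+1}-r_i|\le 1$ for all $i$. $\mathcal{I}_m(n)$ denotes the number of perfect lattice paths in $T_{m,n}$. (This identity was conjectured by A. R. Povolotsky and is proved in the paper.) -}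

module Defs where

open import Data.Nat using (ℕ; zero; suc; _≤_)
open import Data.Nat.Properties using (_≤?_)
open import Data.Fin using (Fin; toℕ)
open import Data.List using (allFin)
open import Data.Vec using (Vec; []; _∷_)
open import Data.List using (List; []; _∷_; map; concatMap; filter; length)
open import Data.Product using (_×_; _,_)
open import Data.Unit using (⊤)
open import Relation.Nullary using (Dec; yes; no)
open import Relation.Nullary.Decidable using (_×-dec_)
open import Data.Vec using (toList)

-- All sequences (r_1,...,r_n) with r_i ∈ {1,...,m}; row r is encoded as Fin m (row r ↦ r-1).
allSeqs : (m n : ℕ) → List (Vec (Fin m) n)
allSeqs m zero = [] ∷ []
allSeqs m (suc n) =
  concatMap (λ r → map (r ∷_) (allSeqs m n)) (allFin m)

Adj : ℕ → ℕ → Set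
Adj a b = (a ≤ suc b) × (b ≤ suc a)

adj? : (a b : ℕ) → Dec (Adj a b)
adj? a b = (a ≤? suc b) ×-dec (b ≤? suc a)

-- A sequence is a perfect lattice path iff consecutive entries differ by at most 1.
IsPath : {m n : ℕ} → Vec (Fin m) n → Set
IsPath [] = ⊤
IsPath (r ∷ []) = ⊤
IsPath (r ∷ s ∷ rs) = Adj (toℕ r) (toℕ s) × IsPath (s ∷ rs)

isPath? : {m n : ℕ} → (v : Vec (Fin m) n) → Dec (IsPath v)
isPath? [] = yes _
isPath? (r ∷ []) = yes _
isPath? (r ∷ s ∷ rs) = adj? (toℕ r) (toℕ s) ×-dec isPath? (s ∷ rs)

𝓘 : ℕ → ℕ → ℕ
𝓘 m n = length (filter isPath? (allSeqs m n))

-- Write G n = 𝓘_n(n) and U k for the number of k-step walks (steps -1, 0, +1) on the half-line ℕ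
-- started at 0. Reading a path column by column, each path extends in three ways except at the
-- bottom and top rows; while the table has more rows than the path has steps, the paths ending
-- there are counted by U k (the top by reflection), and adding a row adds 3^k paths. Hence
-- G (n+1) = 3 G n + 3^n - 2 U (n-1), so (E - 3)² G n = 2 M (n-1) with E the shift and
-- M k = 3 U k - U (k+1) the Motzkin numbers, which are computed from trinomial coefficients.
-- The operator of the theorem factors as ((n+3) E² - (2n+3) E - 3n) (E - 3)², and its left factor
-- annihilates the Motzkin numbers: (n+3) M (n+1) = (2n+3) M n + 3n M (n-1).
module Submission where

open import Relation.Binary.PropositionalEquality
open ≡-Reasoning

module LatticePaths where
  open import Data.Bool.Base using (true; false; if_then_else_)
  open import Data.Bool.Properties using (if-eta)
  open import Data.Fin.Base as Fin using (Fin; toℕ)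
  open import Data.Fin.Properties using (toℕ<n)
  open import Data.List.Base using (List; []; _∷_; _++_; map; concatMap; filter; length; tabulate; allFin)
  open import Data.List.Properties using (filter-++; length-++; map-concatMap; map-tabulate)
  open import Data.Nat.Base
  open import Data.Nat.ListAction using (sum)
  open import Data.Nat.Properties
  open import Algebra.Properties.CommutativeSemigroup +-commutativeSemigroup using (interchange; xy∙z≈zy∙x; xy∙z≈xz∙y)
  open import Data.Nat.Tactic.RingSolver using (solve-∀)
  open import Data.Vec.Base using (Vec; _∷_)
  open import Function.Base using (_∘_; id)
  open import Relation.Nullary.Decidable using (does; dec-true; dec-false)
  open import Relation.Unary using (Decidable)
  open import Defs

  ∑< : ℕ → (ℕ → ℕ) → ℕ
  ∑< zero    f = 0
  ∑< (suc m) f = ∑< m f + f m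

  syntax ∑< m (λ i → e) = ∑[ i < m ] e

  ∑-cong : ∀ m {f g : ℕ → ℕ} → (∀ i → i < m → f i ≡ g i) → ∑< m f ≡ ∑< m g
  ∑-cong zero    eq = refl
  ∑-cong (suc m) eq = cong₂ _+_ (∑-cong m (λ i i<m → eq i (m<n⇒m<1+n i<m))) (eq m ≤-refl)

  ∑-distrib-+ : ∀ m (f g : ℕ → ℕ) → ∑[ i < m ] (f i + g i) ≡ ∑< m f + ∑< m g
  ∑-distrib-+ zero    f g = refl
  ∑-distrib-+ (suc m) f g = trans (cong (_+ (f m + g m)) (∑-distrib-+ m f g)) (interchange (∑< m f) (∑< m g) (f m) (g m))

  ∑-zero : ∀ m → ∑[ i < m ] 0 ≡ 0
  ∑-zero zero    = refl
  ∑-zero (suc m) = trans (+-identityʳ _) (∑-zero m)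

  ∑-one : ∀ m → ∑[ i < m ] 1 ≡ m
  ∑-one zero    = refl
  ∑-one (suc m) = trans (cong (_+ 1) (∑-one m)) (+-comm m 1)

  ∑-suc : ∀ m (f : ℕ → ℕ) → ∑< (suc m) f ≡ f 0 + ∑< m (f ∘ suc)
  ∑-suc zero    f = +-comm 0 (f 0)
  ∑-suc (suc m) f = trans (cong (_+ f (suc m)) (∑-suc m f)) (+-assoc (f 0) _ _)

  ∑-delta : ∀ m c (f : ℕ → ℕ) → (∀ i → m ≤ i → f i ≡ 0) →
            ∑[ i < m ] (if does (c ≟ i) then f i else 0) ≡ f c
  ∑-delta zero    c       f f≥m≡0 = sym (f≥m≡0 c z≤n)
  ∑-delta (suc m) zero    f f≥m≡0 = trans (∑-suc m _) (trans (cong (f 0 +_) (∑-zero m)) (+-identityʳ (f 0)))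
  ∑-delta (suc m) (suc c) f f≥m≡0 =
    trans (∑-suc m _) (∑-delta m c (f ∘ suc) (λ i m≤i → f≥m≡0 (suc i) (s≤s m≤i)))

  below : (ℕ → ℕ) → ℕ → ℕ
  below f zero    = 0
  below f (suc i) = f i

  neighbours : (ℕ → ℕ) → ℕ → ℕ
  neighbours f i = below f i + f i + f (suc i)

  suc-≤ᵇ : ∀ a b → (suc a ≤ᵇ suc b) ≡ (a ≤ᵇ b)
  suc-≤ᵇ zero    b = refl
  suc-≤ᵇ (suc a) b = refl

  adjacent-split : ∀ i j x →
    (if does (adj? i j) then x else 0) ≡
    (if does (i ≟ suc j) then x else 0) + (if does (i ≟ j) then x else 0) + (if does (suc i ≟ j) then x else 0)
  adjacent-split zero          zero          x = sym (+-identityʳ x)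
  adjacent-split zero          (suc zero)    x = refl
  adjacent-split zero          (suc (suc j)) x = refl
  adjacent-split (suc zero)    zero          x = sym (trans (+-identityʳ (x + 0)) (+-identityʳ x))
  adjacent-split (suc (suc i)) zero          x = refl
  adjacent-split (suc i)       (suc j)       x rewrite suc-≤ᵇ i (suc j) | suc-≤ᵇ j (suc i) = adjacent-split i j x

  ∑-adjacent : ∀ m i (f : ℕ → ℕ) → (∀ j → m ≤ j → f j ≡ 0) →
               ∑[ j < m ] (if does (adj? i j) then f j else 0) ≡ neighbours f i
  ∑-adjacent m i f f≥m≡0 = begin
      ∑[ j < m ] (if does (adj? i j) then f j else 0)
    ≡⟨ ∑-cong m (λ j _ → adjacent-split i j (f j)) ⟩
      ∑[ j < m ] (fromBelow j + fromSame j + fromAbove j)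
    ≡⟨ trans (∑-distrib-+ m _ fromAbove) (cong (_+ ∑< m fromAbove) (∑-distrib-+ m fromBelow fromSame)) ⟩
      ∑< m fromBelow + ∑< m fromSame + ∑< m fromAbove
    ≡⟨ cong₂ _+_ (cong₂ _+_ (∑-below i) (∑-delta m i f f≥m≡0)) (∑-delta m (suc i) f f≥m≡0) ⟩
      neighbours f i
    ∎
    where
    fromBelow fromSame fromAbove : ℕ → ℕ
    fromBelow j = if does (i ≟ suc j) then f j else 0
    fromSame  j = if does (i ≟ j) then f j else 0
    fromAbove j = if does (suc i ≟ j) then f j else 0
    ∑-below : ∀ i → ∑[ j < m ] (if does (i ≟ suc j) then f j else 0) ≡ below f i
    ∑-below zero    = ∑-zero m
    ∑-below (suc i) = ∑-delta m i f f≥m≡0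

  restrict : ℕ → (ℕ → ℕ) → ℕ → ℕ
  restrict m f i = if does (i <? m) then f i else 0

  restrict-< : ∀ {m i} f → i < m → restrict m f i ≡ f i
  restrict-< {m} {i} f i<m rewrite dec-true (i <? m) i<m = refl

  restrict-≥ : ∀ {m i} f → m ≤ i → restrict m f i ≡ 0
  restrict-≥ {m} {i} f m≤i rewrite dec-false (i <? m) (≤⇒≯ m≤i) = refl

  -- walks m k i counts the k-step walks (steps -1, 0, +1) in rows 0, …, m - 1 starting at row i,
  -- that is, the perfect lattice paths of T_{m,k+1} starting in its row i + 1.
  walks : ℕ → ℕ → ℕ → ℕ
  walks m zero    = restrict m (λ _ → 1)
  walks m (suc k) = restrict m (neighbours (walks m k))

  walks-≥ : ∀ m k {i} → m ≤ i → walks m k i ≡ 0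
  walks-≥ m zero    = restrict-≥ (λ _ → 1)
  walks-≥ m (suc k) = restrict-≥ (neighbours (walks m k))

  length-filter-concatMap : ∀ {A B : Set} {P : A → Set} (P? : Decidable P) (f : B → List A) xs →
    length (filter P? (concatMap f xs)) ≡ sum (map (length ∘ filter P? ∘ f) xs)
  length-filter-concatMap P? f []       = refl
  length-filter-concatMap P? f (x ∷ xs) = begin
    length (filter P? (f x ++ concatMap f xs))                   ≡⟨ cong length (filter-++ P? (f x) _) ⟩
    length (filter P? (f x) ++ filter P? (concatMap f xs))       ≡⟨ length-++ (filter P? (f x)) ⟩
    length (filter P? (f x)) + length (filter P? (concatMap f xs)) ≡⟨ cong (_ +_) (length-filter-concatMap P? f xs) ⟩
    length (filter P? (f x)) + sum (map (length ∘ filter P? ∘ f) xs) ∎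

  sum-allFin : ∀ m {g : Fin m → ℕ} {f : ℕ → ℕ} → (∀ r → g r ≡ f (toℕ r)) → sum (map g (allFin m)) ≡ ∑< m f
  sum-allFin m {g} g≡f = trans (cong sum (map-tabulate id g)) (sum-tabulate m g≡f)
    where
    sum-tabulate : ∀ m {g : Fin m → ℕ} {f : ℕ → ℕ} → (∀ r → g r ≡ f (toℕ r)) → sum (tabulate g) ≡ ∑< m f
    sum-tabulate zero    g≡f = refl
    sum-tabulate (suc m) {g} {f} g≡f = begin
      g Fin.zero + sum (tabulate (g ∘ Fin.suc)) ≡⟨ cong₂ _+_ (g≡f Fin.zero) (sum-tabulate m (g≡f ∘ Fin.suc)) ⟩
      f 0 + ∑< m (f ∘ suc)                      ≡⟨ ∑-suc m f ⟨
      ∑< (suc m) f                              ∎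

  pathsFrom : ∀ {m} k → Fin m → ℕ
  pathsFrom {m} k r = length (filter isPath? (map (r ∷_) (allSeqs m k)))

  length-filter-isPath-∷ : ∀ {m k} (r s : Fin m) (vs : List (Vec (Fin m) k)) →
    length (filter isPath? (map (r ∷_) (map (s ∷_) vs))) ≡
    (if does (adj? (toℕ r) (toℕ s)) then length (filter isPath? (map (s ∷_) vs)) else 0)
  length-filter-isPath-∷ r s []       = sym (if-eta (does (adj? (toℕ r) (toℕ s))))
  length-filter-isPath-∷ r s (v ∷ vs)
    with does (adj? (toℕ r) (toℕ s)) | does (isPath? (s ∷ v)) | length-filter-isPath-∷ r s vs
  ... | true  | true  | ih = cong suc ih
  ... | true  | false | ih = ih
  ... | false | _     | ih = ih

  pathsFrom-walks : ∀ {m} k (r : Fin m) → pathsFrom k r ≡ walks m k (toℕ r)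
  pathsFrom-walks zero    r = sym (restrict-< (λ _ → 1) (toℕ<n r))
  pathsFrom-walks {m} (suc k) r = begin
      length (filter isPath? (map (r ∷_) (concatMap (λ s → map (s ∷_) (allSeqs m k)) (allFin m))))
    ≡⟨ cong (λ vs → length (filter isPath? vs)) (map-concatMap (r ∷_) _ (allFin m)) ⟩
      length (filter isPath? (concatMap (λ s → map (r ∷_) (map (s ∷_) (allSeqs m k))) (allFin m)))
    ≡⟨ length-filter-concatMap isPath? _ (allFin m) ⟩
      sum (map (λ s → length (filter isPath? (map (r ∷_) (map (s ∷_) (allSeqs m k))))) (allFin m))
    ≡⟨ sum-allFin m step ⟩
      ∑[ j < m ] (if does (adj? (toℕ r) j) then walks m k j else 0)
    ≡⟨ ∑-adjacent m (toℕ r) (walks m k) (λ _ → walks-≥ m k) ⟩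
      neighbours (walks m k) (toℕ r)
    ≡⟨ restrict-< (neighbours (walks m k)) (toℕ<n r) ⟨
      walks m (suc k) (toℕ r)
    ∎
    where
    step : ∀ s → length (filter isPath? (map (r ∷_) (map (s ∷_) (allSeqs m k)))) ≡
                 (if does (adj? (toℕ r) (toℕ s)) then walks m k (toℕ s) else 0)
    step s = trans (length-filter-isPath-∷ r s (allSeqs m k))
                   (cong (λ n → if does (adj? (toℕ r) (toℕ s)) then n else 0) (pathsFrom-walks k s))

  𝓘-walks : ∀ m k → 𝓘 m (suc k) ≡ ∑[ i < m ] walks m k i
  𝓘-walks m k = begin
      length (filter isPath? (concatMap (λ r → map (r ∷_) (allSeqs m k)) (allFin m)))
    ≡⟨ length-filter-concatMap isPath? _ (allFin m) ⟩
      sum (map (pathsFrom k) (allFin m))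
    ≡⟨ sum-allFin m (pathsFrom-walks k) ⟩
      ∑[ i < m ] walks m k i
    ∎

  halfLineWalks : ℕ → ℕ → ℕ
  halfLineWalks zero    i = 1
  halfLineWalks (suc k) i = neighbours (halfLineWalks k) i

  neighbours-cong : ∀ {f g : ℕ → ℕ} i → (∀ j → j ≤ suc i → f j ≡ g j) → neighbours f i ≡ neighbours g i
  neighbours-cong zero    f≡g = cong₂ _+_ (f≡g 0 z≤n) (f≡g 1 ≤-refl)
  neighbours-cong (suc i) f≡g =
    cong₂ _+_ (cong₂ _+_ (f≡g i (m≤n⇒m≤1+n (n≤1+n i))) (f≡g (suc i) (n≤1+n (suc i)))) (f≡g (suc (suc i)) ≤-refl)

  walks-halfLine : ∀ m k i → i + k < m → walks m k i ≡ halfLineWalks k i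
  walks-halfLine m zero    i i+k<m = restrict-< (λ _ → 1) (≤-<-trans (m≤m+n i 0) i+k<m)
  walks-halfLine m (suc k) i i+k<m = trans (restrict-< (neighbours (walks m k)) (≤-<-trans (m≤m+n i (suc k)) i+k<m))
    (neighbours-cong i (λ j j≤1+i → walks-halfLine m k j (≤-<-trans (+-monoˡ-≤ k j≤1+i) (subst (_< m) (+-suc i k) i+k<m))))

  walks-reflect : ∀ m k i j → suc (i + j) ≡ m → walks m k i ≡ walks m k j
  walks-reflect m zero i j refl =
    trans (restrict-< (λ _ → 1) (s≤s (m≤m+n i j))) (sym (restrict-< (λ _ → 1) (s≤s (m≤n+m j i))))
  walks-reflect m (suc k) i j refl = begin
    walks m (suc k) i                ≡⟨ restrict-< (neighbours W) (s≤s (m≤m+n i j)) ⟩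
    below W i + W i + W (suc i)      ≡⟨ cong₂ _+_ (cong₂ _+_ (below-mirror i j refl) (walks-reflect m k i j refl))
                                                  (sym (below-mirror j i (cong suc (+-comm j i)))) ⟩
    W (suc j) + W j + below W j      ≡⟨ xy∙z≈zy∙x (W (suc j)) (W j) (below W j) ⟩
    below W j + W j + W (suc j)      ≡⟨ restrict-< (neighbours W) (s≤s (m≤n+m j i)) ⟨
    walks m (suc k) j                ∎
    where
    W = walks m k
    below-mirror : ∀ a b → suc (a + b) ≡ m → below W a ≡ W (suc b)
    below-mirror zero    b refl = sym (walks-≥ m k ≤-refl)
    below-mirror (suc a) b eq   = walks-reflect m k a (suc b) (trans (cong suc (+-suc a b)) eq)

  ∑-neighbours : ∀ m (f : ℕ → ℕ) → ∑[ i < suc m ] neighbours f i + f 0 + f m ≡ 3 * ∑< (suc m) f + f (suc m)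
  ∑-neighbours zero    f = base (f 0) (f 1)
    where
    base : ∀ a b → a + b + a + a ≡ 3 * a + b
    base = solve-∀
  ∑-neighbours (suc m) f = begin
    N + (f m + f (suc m) + f (2 + m)) + f 0 + f (suc m) ≡⟨ regroup N (f m) (f (suc m)) (f (2 + m)) (f 0) ⟩
    (N + f 0 + f m) + T                                 ≡⟨ cong (_+ T) (∑-neighbours m f) ⟩
    (3 * S + f (suc m)) + T                             ≡⟨ collect S (f (suc m)) (f (2 + m)) ⟩
    3 * (S + f (suc m)) + f (2 + m)                     ∎
    where
    N = ∑[ i < suc m ] neighbours f i
    S = ∑< (suc m) f
    T = f (suc m) + f (suc m) + f (2 + m)
    regroup : ∀ n a b c z → n + (a + b + c) + z + b ≡ (n + z + a) + (b + b + c)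
    regroup = solve-∀
    collect : ∀ s b c → (3 * s + b) + (b + b + c) ≡ 3 * (s + b) + c
    collect = solve-∀

  𝓘-one-column : ∀ m → 𝓘 m 1 ≡ m
  𝓘-one-column m = trans (𝓘-walks m 0) (trans (∑-cong m (λ i → restrict-< {m} {i} (λ _ → 1))) (∑-one m))

  -- Summed over the start row, walks m k j is counted once per neighbour of j: three times, except
  -- twice at the bottom and top rows, where for k < m it equals halfLineWalks k 0.
  𝓘-add-column : ∀ m k → k < suc m → 𝓘 (suc m) (2 + k) + 2 * halfLineWalks k 0 ≡ 3 * 𝓘 (suc m) (1 + k)
  𝓘-add-column m k k<1+m = begin
    𝓘 (suc m) (2 + k) + 2 * U                       ≡⟨ cong₂ _+_ ∑-walks-suc (cong (U +_) (+-identityʳ U)) ⟩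
    N + (U + U)                                    ≡⟨ +-assoc N U U ⟨
    N + U + U                                      ≡⟨ cong₂ (λ a b → N + a + b) W₀≡U Wₘ≡U ⟨
    N + W 0 + W m                                  ≡⟨ ∑-neighbours m W ⟩
    3 * ∑< (suc m) W + W (suc m)                   ≡⟨ cong (3 * ∑< (suc m) W +_) (walks-≥ (suc m) k ≤-refl) ⟩
    3 * ∑< (suc m) W + 0                           ≡⟨ +-identityʳ _ ⟩
    3 * ∑< (suc m) W                               ≡⟨ cong (3 *_) (𝓘-walks (suc m) k) ⟨
    3 * 𝓘 (suc m) (1 + k)                          ∎
    where
    W = walks (suc m) k
    U = halfLineWalks k 0
    N = ∑[ i < suc m ] neighbours W i
    W₀≡U : W 0 ≡ U
    W₀≡U = walks-halfLine (suc m) k 0 k<1+m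
    Wₘ≡U : W m ≡ U
    Wₘ≡U = trans (walks-reflect (suc m) k m 0 (cong suc (+-identityʳ m))) W₀≡U
    ∑-walks-suc : 𝓘 (suc m) (2 + k) ≡ N
    ∑-walks-suc = trans (𝓘-walks (suc m) (suc k)) (∑-cong (suc m) (λ i → restrict-< {suc m} {i} (neighbours W)))

  -- Both tables satisfy 𝓘-add-column with the same loss 2 * halfLineWalks k 0, so their difference
  -- triples with each column.
  𝓘-add-row : ∀ m k → k ≤ m → 𝓘 (suc m) (suc k) ≡ 𝓘 m (suc k) + 3 ^ k
  𝓘-add-row m       zero    _            = begin
    𝓘 (suc m) 1 ≡⟨ 𝓘-one-column (suc m) ⟩
    suc m       ≡⟨ +-comm 1 m ⟩
    m + 1       ≡⟨ cong (_+ 1) (𝓘-one-column m) ⟨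
    𝓘 m 1 + 1   ∎
  𝓘-add-row (suc m) (suc k) (s≤s k≤m) = +-cancelʳ-≡ (2 * U) _ _ (begin
    𝓘 (2 + m) (2 + k) + 2 * U           ≡⟨ 𝓘-add-column (suc m) k (m<n⇒m<1+n (s≤s k≤m)) ⟩
    3 * 𝓘 (2 + m) (1 + k)               ≡⟨ cong (3 *_) (𝓘-add-row (suc m) k (m≤n⇒m≤1+n k≤m)) ⟩
    3 * (𝓘 (1 + m) (1 + k) + 3 ^ k)     ≡⟨ *-distribˡ-+ 3 (𝓘 (1 + m) (1 + k)) (3 ^ k) ⟩
    3 * 𝓘 (1 + m) (1 + k) + 3 ^ (1 + k) ≡⟨ cong (_+ 3 ^ (1 + k)) (𝓘-add-column m k (s≤s k≤m)) ⟨
    𝓘 (1 + m) (2 + k) + 2 * U + 3 ^ (1 + k) ≡⟨ xy∙z≈xz∙y (𝓘 (1 + m) (2 + k)) (2 * U) (3 ^ (1 + k)) ⟩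
    𝓘 (1 + m) (2 + k) + 3 ^ (1 + k) + 2 * U ∎)
    where
    U = halfLineWalks k 0

  𝓘-diagonal-step : ∀ k → 𝓘 (2 + k) (2 + k) + 2 * halfLineWalks k 0 ≡ 3 * 𝓘 (1 + k) (1 + k) + 3 ^ (1 + k)
  𝓘-diagonal-step k = begin
    𝓘 (2 + k) (2 + k) + 2 * halfLineWalks k 0 ≡⟨ 𝓘-add-column (suc k) k (m<n⇒m<1+n ≤-refl) ⟩
    3 * 𝓘 (2 + k) (1 + k)                      ≡⟨ cong (3 *_) (𝓘-add-row (suc k) k (n≤1+n k)) ⟩
    3 * (𝓘 (1 + k) (1 + k) + 3 ^ k)            ≡⟨ *-distribˡ-+ 3 (𝓘 (1 + k) (1 + k)) (3 ^ k) ⟩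
    3 * 𝓘 (1 + k) (1 + k) + 3 ^ (1 + k)        ∎

module Trinomials where
  open import Data.Nat.Base
  open import Data.Nat.Properties
  open import Data.Nat.Tactic.RingSolver using (solve-∀)
  open LatticePaths using (∑<; ∑-cong; ∑-suc; ∑-zero; below; halfLineWalks)

  -- trinomial n d is the coefficient of x^d in (x⁻¹ + 1 + x)^n; the clause for d = 0 uses that the
  -- coefficient of x⁻¹ equals that of x.
  trinomial : ℕ → ℕ → ℕ
  trinomial zero    zero    = 1
  trinomial zero    (suc d) = 0
  trinomial (suc n) zero    = trinomial n 1 + trinomial n 0 + trinomial n 1
  trinomial (suc n) (suc d) = trinomial n d + trinomial n (suc d) + trinomial n (suc (suc d))

  trinomial-contiguity : ∀ n d → suc d * trinomial (suc n) (suc d) + suc n * trinomial n (2 + d) ≡ suc n * trinomial n d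
  trinomial-contiguity zero    zero    = refl
  trinomial-contiguity zero    (suc d) = trans (+-identityʳ _) (*-zeroʳ (2 + d))
  trinomial-contiguity (suc n) zero    = begin
      1 * (a₀ + a₁ + a₂) + (2 + n) * a₂
    ≡⟨ split n y₀ y₁ y₂ y₃ ⟩
      (1 * a₁ + suc n * y₂) + (2 * a₂ + suc n * y₃) + (y₀ + (3 + n) * y₁)
    ≡⟨ cong₂ (λ p q → p + q + (y₀ + (3 + n) * y₁)) (trinomial-contiguity n 0) (trinomial-contiguity n 1) ⟩
      suc n * y₀ + suc n * y₁ + (y₀ + (3 + n) * y₁)
    ≡⟨ join n y₀ y₁ ⟩
      (2 + n) * a₀
    ∎
    where
    y₀ = trinomial n 0; y₁ = trinomial n 1; y₂ = trinomial n 2; y₃ = trinomial n 3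
    a₀ = y₁ + y₀ + y₁; a₁ = y₀ + y₁ + y₂; a₂ = y₁ + y₂ + y₃
    split : ∀ n y₀ y₁ y₂ y₃ →
      1 * ((y₁ + y₀ + y₁) + (y₀ + y₁ + y₂) + (y₁ + y₂ + y₃)) + (2 + n) * (y₁ + y₂ + y₃) ≡
      (1 * (y₀ + y₁ + y₂) + suc n * y₂) + (2 * (y₁ + y₂ + y₃) + suc n * y₃) + (y₀ + (3 + n) * y₁)
    split = solve-∀
    join : ∀ n y₀ y₁ → suc n * y₀ + suc n * y₁ + (y₀ + (3 + n) * y₁) ≡ (2 + n) * (y₁ + y₀ + y₁)
    join = solve-∀
  trinomial-contiguity (suc n) (suc e) = begin
      (2 + e) * (a₀ + a₁ + a₂) + (2 + n) * a₂
    ≡⟨ split n e y₀ y₁ y₂ y₃ y₄ ⟩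
      (suc e * a₀ + suc n * y₂) + ((2 + e) * a₁ + suc n * y₃) + ((3 + e) * a₂ + suc n * y₄) + a₀
    ≡⟨ cong₂ (λ p q → p + q + a₀) (cong₂ _+_ (trinomial-contiguity n e) (trinomial-contiguity n (suc e)))
                                    (trinomial-contiguity n (2 + e)) ⟩
      suc n * y₀ + suc n * y₁ + suc n * y₂ + a₀
    ≡⟨ join n y₀ y₁ y₂ ⟩
      (2 + n) * a₀
    ∎
    where
    y₀ = trinomial n e; y₁ = trinomial n (1 + e); y₂ = trinomial n (2 + e); y₃ = trinomial n (3 + e); y₄ = trinomial n (4 + e)
    a₀ = y₀ + y₁ + y₂; a₁ = y₁ + y₂ + y₃; a₂ = y₂ + y₃ + y₄
    split : ∀ n e y₀ y₁ y₂ y₃ y₄ →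
      (2 + e) * ((y₀ + y₁ + y₂) + (y₁ + y₂ + y₃) + (y₂ + y₃ + y₄)) + (2 + n) * (y₂ + y₃ + y₄) ≡
      (suc e * (y₀ + y₁ + y₂) + suc n * y₂) + ((2 + e) * (y₁ + y₂ + y₃) + suc n * y₃)
        + ((3 + e) * (y₂ + y₃ + y₄) + suc n * y₄) + (y₀ + y₁ + y₂)
    split = solve-∀
    join : ∀ n y₀ y₁ y₂ → suc n * y₀ + suc n * y₁ + suc n * y₂ + (y₀ + y₁ + y₂) ≡ (2 + n) * (y₀ + y₁ + y₂)
    join = solve-∀

  ∑-prefix-triple : ∀ (w : ℕ → ℕ) i →
    ∑< i w + ∑< (1 + i) w + ∑< (2 + i) w ≡ ∑[ d < suc i ] (w (pred d) + w d + w (suc d))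
  ∑-prefix-triple w zero    = sym (+-assoc (w 0) (w 0) (w 1))
  ∑-prefix-triple w (suc i) = begin
    (∑< i w + w i) + (∑< (1 + i) w + w (1 + i)) + (∑< (2 + i) w + w (2 + i)) ≡⟨ interchange₃ (∑< i w) _ _ (w i) _ _ ⟩
    (∑< i w + ∑< (1 + i) w + ∑< (2 + i) w) + T                                ≡⟨ cong (_+ T) (∑-prefix-triple w i) ⟩
    ∑[ d < suc i ] (w (pred d) + w d + w (suc d)) + T                          ∎
    where
    T = w i + w (1 + i) + w (2 + i)
    interchange₃ : ∀ a b c x y z → (a + x) + (b + y) + (c + z) ≡ (a + b + c) + (x + y + z)
    interchange₃ = solve-∀

  trinomialPair : ℕ → ℕ → ℕ
  trinomialPair n d = trinomial n d + trinomial n (suc d)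

  -- For d = 0, trinomialPair n (pred d) stands for the pair at -1, equal to the pair at 0 by symmetry.
  trinomialPair-suc : ∀ n d → trinomialPair (suc n) d ≡ trinomialPair n (pred d) + trinomialPair n d + trinomialPair n (suc d)
  trinomialPair-suc n zero    = regroup (trinomial n 0) (trinomial n 1) (trinomial n 2)
    where
    regroup : ∀ y₀ y₁ y₂ → (y₁ + y₀ + y₁) + (y₀ + y₁ + y₂) ≡ (y₀ + y₁) + (y₀ + y₁) + (y₁ + y₂)
    regroup = solve-∀
  trinomialPair-suc n (suc d) = regroup (trinomial n d) (trinomial n (1 + d)) (trinomial n (2 + d)) (trinomial n (3 + d))
    where
    regroup : ∀ y₀ y₁ y₂ y₃ → (y₀ + y₁ + y₂) + (y₁ + y₂ + y₃) ≡ (y₀ + y₁) + (y₁ + y₂) + (y₂ + y₃)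
    regroup = solve-∀

  halfLineWalks-trinomial : ∀ k i → halfLineWalks k i ≡ ∑[ d < suc i ] trinomialPair k d
  halfLineWalks-trinomial zero    i = sym (trans (∑-suc i (trinomialPair 0)) (cong suc (∑-zero i)))
  halfLineWalks-trinomial (suc k) i = begin
    below (halfLineWalks k) i + halfLineWalks k i + halfLineWalks k (suc i)
      ≡⟨ cong₂ _+_ (cong₂ _+_ (below-prefix i) (halfLineWalks-trinomial k i)) (halfLineWalks-trinomial k (suc i)) ⟩
    ∑< i (trinomialPair k) + ∑< (1 + i) (trinomialPair k) + ∑< (2 + i) (trinomialPair k)
      ≡⟨ ∑-prefix-triple (trinomialPair k) i ⟩
    ∑[ d < suc i ] (trinomialPair k (pred d) + trinomialPair k d + trinomialPair k (suc d))
      ≡⟨ ∑-cong (suc i) (λ d _ → trinomialPair-suc k d) ⟨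
    ∑[ d < suc i ] trinomialPair (suc k) d ∎
    where
    below-prefix : ∀ i → below (halfLineWalks k) i ≡ ∑< i (trinomialPair k)
    below-prefix zero    = refl
    below-prefix (suc i) = halfLineWalks-trinomial k i

module Recurrences where
  open import Data.Nat.Base as ℕ using (ℕ; suc)
  import Data.Nat.Properties as ℕₚ
  open import Data.Integer.Base using (ℤ; +_; _+_; _-_; _*_)
  open import Data.Integer.Properties using (pos-*)
  open import Data.Integer.Tactic.RingSolver using (solve-∀)
  open import Defs using (𝓘)
  open LatticePaths using (𝓘-diagonal-step; halfLineWalks)
  open Trinomials using (trinomial; trinomial-contiguity; halfLineWalks-trinomial)

  diagonal : ℕ → ℤ
  diagonal n = + 𝓘 n n

  halfLine : ℕ → ℤ
  halfLine k = + halfLineWalks k 0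

  motzkin : ℕ → ℤ
  motzkin k = + trinomial k 0 - + trinomial k 2

  m+n≡o⇒+m≡+o-+n : ∀ {m n o : ℕ} → m ℕ.+ n ≡ o → + m ≡ + o - + n
  m+n≡o⇒+m≡+o-+n {m} {n} refl = cancel (+ m) (+ n)
    where
    cancel : ∀ a b → a ≡ a + b - b
    cancel = solve-∀

  diagonal-first-order : ∀ k → diagonal (2 ℕ.+ k) ≡ + 3 * diagonal (1 ℕ.+ k) + + (3 ℕ.^ (1 ℕ.+ k)) - + 2 * halfLine k
  diagonal-first-order k = begin
      diagonal (2 ℕ.+ k)
    ≡⟨ m+n≡o⇒+m≡+o-+n (𝓘-diagonal-step k) ⟩
      + (3 ℕ.* 𝓘 (1 ℕ.+ k) (1 ℕ.+ k)) + + (3 ℕ.^ (1 ℕ.+ k)) - + (2 ℕ.* halfLineWalks k 0)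
    ≡⟨ cong₂ (λ a b → a + + (3 ℕ.^ (1 ℕ.+ k)) - b) (pos-* 3 (𝓘 (1 ℕ.+ k) (1 ℕ.+ k))) (pos-* 2 (halfLineWalks k 0)) ⟩
      + 3 * diagonal (1 ℕ.+ k) + + (3 ℕ.^ (1 ℕ.+ k)) - + 2 * halfLine k
    ∎

  halfLine-motzkin : ∀ k → + 3 * halfLine k - halfLine (1 ℕ.+ k) ≡ motzkin k
  halfLine-motzkin k = begin
    + 3 * halfLine k - halfLine (1 ℕ.+ k)
      ≡⟨ cong₂ (λ a b → + 3 * + a - + b) (halfLineWalks-trinomial k 0) (halfLineWalks-trinomial (suc k) 0) ⟩
    + 3 * (+ trinomial k 0 + + trinomial k 1) - (+ trinomial (suc k) 0 + + trinomial (suc k) 1)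
      ≡⟨ identity (+ trinomial k 0) (+ trinomial k 1) (+ trinomial k 2) ⟩
    motzkin k ∎
    where
    identity : ∀ c b e → + 3 * (c + b) - ((b + c + b) + (c + b + e)) ≡ c - e
    identity = solve-∀

  diagonal-second-order : ∀ k →
    diagonal (3 ℕ.+ k) ≡ + 6 * diagonal (2 ℕ.+ k) - + 9 * diagonal (1 ℕ.+ k) + + 2 * motzkin k
  diagonal-second-order k = begin
    diagonal (3 ℕ.+ k)
      ≡⟨ eliminate-power (diagonal (1 ℕ.+ k)) p (halfLine k) (halfLine (1 ℕ.+ k)) (diagonal-first-order k) next-step ⟩
    + 6 * diagonal (2 ℕ.+ k) - + 9 * diagonal (1 ℕ.+ k) + + 2 * (+ 3 * halfLine k - halfLine (1 ℕ.+ k))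
      ≡⟨ cong (λ μ → + 6 * diagonal (2 ℕ.+ k) - + 9 * diagonal (1 ℕ.+ k) + + 2 * μ) (halfLine-motzkin k) ⟩
    + 6 * diagonal (2 ℕ.+ k) - + 9 * diagonal (1 ℕ.+ k) + + 2 * motzkin k ∎
    where
    p = + (3 ℕ.^ (1 ℕ.+ k))
    next-step : diagonal (3 ℕ.+ k) ≡ + 3 * diagonal (2 ℕ.+ k) + + 3 * p - + 2 * halfLine (1 ℕ.+ k)
    next-step = trans (diagonal-first-order (1 ℕ.+ k))
                      (cong (λ q → + 3 * diagonal (2 ℕ.+ k) + q - + 2 * halfLine (1 ℕ.+ k)) (pos-* 3 (3 ℕ.^ (1 ℕ.+ k))))
    eliminate-power : ∀ g₁ p u₀ u₁ {g₂ g₃} →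
                      g₂ ≡ + 3 * g₁ + p - + 2 * u₀ → g₃ ≡ + 3 * g₂ + + 3 * p - + 2 * u₁ →
                      g₃ ≡ + 6 * g₂ - + 9 * g₁ + + 2 * (+ 3 * u₀ - u₁)
    eliminate-power g₁ p u₀ u₁ refl refl = identity g₁ p u₀ u₁
      where
      identity : ∀ g₁ p u₀ u₁ → let g₂ = + 3 * g₁ + p - + 2 * u₀ in
                 + 3 * g₂ + + 3 * p - + 2 * u₁ ≡ + 6 * g₂ - + 9 * g₁ + + 2 * (+ 3 * u₀ - u₁)
      identity = solve-∀

  trinomial-suc-1-motzkin : ∀ k → + trinomial (1 ℕ.+ k) 1 ≡ + (1 ℕ.+ k) * motzkin k
  trinomial-suc-1-motzkin k = begin
    + trinomial (1 ℕ.+ k) 1                ≡⟨ m+n≡o⇒+m≡+o-+n contiguity ⟩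
    + (K ℕ.* c) - + (K ℕ.* e)             ≡⟨ cong₂ _-_ (pos-* K c) (pos-* K e) ⟩
    + K * + c - + K * + e                 ≡⟨ factor (+ K) (+ c) (+ e) ⟩
    + K * motzkin k                       ∎
    where
    K = 1 ℕ.+ k
    c = trinomial k 0
    e = trinomial k 2
    contiguity : trinomial K 1 ℕ.+ K ℕ.* e ≡ K ℕ.* c
    contiguity = trans (cong (ℕ._+ K ℕ.* e) (sym (ℕₚ.*-identityˡ (trinomial K 1)))) (trinomial-contiguity k 0)
    factor : ∀ a x y → a * x - a * y ≡ a * (x - y)
    factor = solve-∀

  suc-suc-motzkin : ∀ k → + (2 ℕ.+ k) * motzkin k ≡ + 2 * + trinomial k 0 + + trinomial k 1
  suc-suc-motzkin k = identity (+ (1 ℕ.+ k)) (+ trinomial k 0) (+ trinomial k 1) (+ trinomial k 2) (trinomial-suc-1-motzkin k)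
    where
    identity : ∀ a c b e → c + b + e ≡ a * (c - e) → (+ 1 + a) * (c - e) ≡ + 2 * c + b
    identity a c b e h = begin
      (+ 1 + a) * (c - e)      ≡⟨ solve₁ a c e ⟩
      a * (c - e) + (c - e)    ≡⟨ cong (_+ (c - e)) h ⟨
      c + b + e + (c - e)      ≡⟨ solve₂ c b e ⟩
      + 2 * c + b              ∎
      where
      solve₁ : ∀ a c e → (+ 1 + a) * (c - e) ≡ a * (c - e) + (c - e)
      solve₁ = solve-∀
      solve₂ : ∀ c b e → c + b + e + (c - e) ≡ + 2 * c + b
      solve₂ = solve-∀

  motzkin-recurrence : ∀ k → let n = + suc k in
    (+ 3 + n) * motzkin (2 ℕ.+ k) ≡ (+ 2 * n + + 3) * motzkin (1 ℕ.+ k) + + 3 * n * motzkin k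
  motzkin-recurrence k =
    identity (+ suc k) (motzkin k) (motzkin (1 ℕ.+ k)) (motzkin (2 ℕ.+ k)) (+ trinomial (1 ℕ.+ k) 0)
      (suc-suc-motzkin (2 ℕ.+ k)) (suc-suc-motzkin (1 ℕ.+ k)) (trinomial-suc-1-motzkin k) (trinomial-suc-1-motzkin (1 ℕ.+ k))
    where
    identity : ∀ n μ₀ μ₁ μ₂ c₁ {b₁ b₂} →
      (+ 3 + n) * μ₂ ≡ + 2 * (b₁ + c₁ + b₁) + b₂ → (+ 2 + n) * μ₁ ≡ + 2 * c₁ + b₁ →
      b₁ ≡ n * μ₀ → b₂ ≡ (+ 1 + n) * μ₁ →
      (+ 3 + n) * μ₂ ≡ (+ 2 * n + + 3) * μ₁ + + 3 * n * μ₀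
    identity n μ₀ μ₁ μ₂ c₁ eq₂ eq₁ refl refl = begin
      (+ 3 + n) * μ₂                                         ≡⟨ eq₂ ⟩
      + 2 * (b₁ + c₁ + b₁) + (+ 1 + n) * μ₁                 ≡⟨ regroup c₁ b₁ ((+ 1 + n) * μ₁) ⟩
      (+ 2 * c₁ + b₁) + (+ 3 * b₁ + (+ 1 + n) * μ₁)         ≡⟨ cong (_+ (+ 3 * b₁ + (+ 1 + n) * μ₁)) eq₁ ⟨
      (+ 2 + n) * μ₁ + (+ 3 * b₁ + (+ 1 + n) * μ₁)          ≡⟨ collect n μ₀ μ₁ ⟩
      (+ 2 * n + + 3) * μ₁ + + 3 * n * μ₀                   ∎
      where
      b₁ = n * μ₀
      regroup : ∀ c b x → + 2 * (b + c + b) + x ≡ (+ 2 * c + b) + (+ 3 * b + x)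
      regroup = solve-∀
      collect : ∀ n μ₀ μ₁ →
        (+ 2 + n) * μ₁ + (+ 3 * (n * μ₀) + (+ 1 + n) * μ₁) ≡ (+ 2 * n + + 3) * μ₁ + + 3 * n * μ₀
      collect = solve-∀

  fourth-order-recurrence : ∀ n g₀ g₁ {g₂ g₃ g₄ μ₀ μ₁ μ₂ : ℤ} →
    g₂ ≡ + 6 * g₁ - + 9 * g₀ + + 2 * μ₀ →
    g₃ ≡ + 6 * g₂ - + 9 * g₁ + + 2 * μ₁ →
    g₄ ≡ + 6 * g₃ - + 9 * g₂ + + 2 * μ₂ →
    (+ 3 + n) * μ₂ ≡ (+ 2 * n + + 3) * μ₁ + + 3 * n * μ₀ →
    (n + + 3) * g₄ ≡ + 27 * n * g₀ + + 27 * g₁ - + 9 * (+ 2 * n + + 5) * g₂ + (+ 8 * n + + 21) * g₃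
  fourth-order-recurrence n g₀ g₁ {μ₀ = μ₀} {μ₁} {μ₂} refl refl refl motzkin-rec = begin
      (n + + 3) * g₄
    ≡⟨ factor n g₀ g₁ μ₀ μ₁ μ₂ ⟩
      R + + 2 * ((+ 3 + n) * μ₂ - ((+ 2 * n + + 3) * μ₁ + + 3 * n * μ₀))
    ≡⟨ cong (λ x → R + + 2 * (x - ((+ 2 * n + + 3) * μ₁ + + 3 * n * μ₀))) motzkin-rec ⟩
      R + + 2 * (((+ 2 * n + + 3) * μ₁ + + 3 * n * μ₀) - ((+ 2 * n + + 3) * μ₁ + + 3 * n * μ₀))
    ≡⟨ vanish R ((+ 2 * n + + 3) * μ₁ + + 3 * n * μ₀) ⟩
      R
    ∎
    where
    g₂ = + 6 * g₁ - + 9 * g₀ + + 2 * μ₀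
    g₃ = + 6 * g₂ - + 9 * g₁ + + 2 * μ₁
    g₄ = + 6 * g₃ - + 9 * g₂ + + 2 * μ₂
    R = + 27 * n * g₀ + + 27 * g₁ - + 9 * (+ 2 * n + + 5) * g₂ + (+ 8 * n + + 21) * g₃
    factor : ∀ n g₀ g₁ μ₀ μ₁ μ₂ →
      let g₂ = + 6 * g₁ - + 9 * g₀ + + 2 * μ₀
          g₃ = + 6 * g₂ - + 9 * g₁ + + 2 * μ₁
          g₄ = + 6 * g₃ - + 9 * g₂ + + 2 * μ₂
      in (n + + 3) * g₄ ≡
         (+ 27 * n * g₀ + + 27 * g₁ - + 9 * (+ 2 * n + + 5) * g₂ + (+ 8 * n + + 21) * g₃)
         + + 2 * ((+ 3 + n) * μ₂ - ((+ 2 * n + + 3) * μ₁ + + 3 * n * μ₀))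
    factor = solve-∀
    vanish : ∀ r x → r + + 2 * (x - x) ≡ r
    vanish = solve-∀

  -- The statement's indices n + j do not reduce for a variable n; this form lets them be matched.
  diagonal-second-order-at : ∀ k {a b c} → a ≡ 3 ℕ.+ k → b ≡ 2 ℕ.+ k → c ≡ 1 ℕ.+ k →
    diagonal a ≡ + 6 * diagonal b - + 9 * diagonal c + + 2 * motzkin k
  diagonal-second-order-at k refl refl refl = diagonal-second-order k

open import Defs
open import Data.Nat using (ℕ; suc)
open import Data.Integer using (ℤ; +_; _+_; _-_; _*_)
import Data.Nat
import Data.Nat as ℕ
open import Data.Nat.Properties using (+-comm)
open import Data.Integer.Properties using (pos-*)
open Recurrences using (diagonal; diagonal-second-order-at; motzkin-recurrence; fourth-order-recurrence)

mainTheorem1 : (n : ℕ) → 1 Data.Nat.≤ n →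
    (+ (n Data.Nat.+ 3)) * (+ 𝓘 (n Data.Nat.+ 4) (n Data.Nat.+ 4))
      ≡ (+ 27) * (+ n) * (+ 𝓘 n n)
        + (+ 27) * (+ 𝓘 (n Data.Nat.+ 1) (n Data.Nat.+ 1))
        - (+ 9) * (+ (2 Data.Nat.* n Data.Nat.+ 5)) * (+ 𝓘 (n Data.Nat.+ 2) (n Data.Nat.+ 2))
        + (+ (8 Data.Nat.* n Data.Nat.+ 21)) * (+ 𝓘 (n Data.Nat.+ 3) (n Data.Nat.+ 3))
mainTheorem1 n@(suc k) _ = trans
  (fourth-order-recurrence (+ n) (diagonal n) (diagonal (n ℕ.+ 1))
    (diagonal-second-order-at k (shift 2) (shift 1) refl)
    (diagonal-second-order-at (1 ℕ.+ k) (shift 3) (shift 2) (shift 1))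
    (diagonal-second-order-at (2 ℕ.+ k) (shift 4) (shift 3) (shift 2))
    (motzkin-recurrence k))
  (cong₂ (λ a b → + 27 * + n * diagonal n + + 27 * diagonal (n ℕ.+ 1)
                  - + 9 * (a + + 5) * diagonal (n ℕ.+ 2) + (b + + 21) * diagonal (n ℕ.+ 3))
         (sym (pos-* 2 n)) (sym (pos-* 8 n)))
  where
  shift : ∀ j → n ℕ.+ j ≡ suc (j ℕ.+ k)
  shift j = cong suc (+-comm k j)
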